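{- Let $\Phi$ be a non-trivial CNF Boolean formula and $0<\varepsilon\le\frac12$, and let $G=G(\Phi,\varepsilon)$ be the formula graph on $n$ vertices with thresholds $\delta$ and $\Delta$. Then $\delta\le\varepsilon n$ and $\Delta\ge(1-\varepsilon)n$; for $F\ge1$ and $\varepsilon=\frac1{F+1}$, moreover $\Delta\ge F\delta$. Furthermore, every vertex of $G$ either has degree at most $\delta$ or has degree strictly greater than $\Delta$.
   Context: Formula graph construction. Write $\Phi=c_1\wedge\cdots\wedge c_k$, where clause $c_i$ is a disjunction of $w_i$ distinct literals; let $x_1,\dots,x_t$ be the atoms occurring, with literals $x_i,\neg x_i$. For a literal $\ell$ let $p(\ell)$ be the number of clauses containing $\ell$, and $m=\max\{w_1,\dots,w_k,2p(x_1),2p(\neg x_1),\dots,2p(x_t),2p(\neg x_t)\}$. Let $n(f)=2+2t+2k+f$ and choose $f$ as the smallest integer with $f\ge m$, $n(f)\ge\frac1\varepsilon(2t+k)$ and $n(f)\ge\frac1\varepsilon(m+3)$; set $n=n(f)$. Vertices: $a,b$; one vertex for each literal $x_i,\neg x_i$; $\alpha_i,\beta_i$ for each clause $c_i$; filler vertices $y_1,\dots,y_f$. Define the graph $H$ on these vertices with edges: $ab$; $x_i\neg x_i$ for each atom; $\alpha_i$ adjacent to $a$ and to each literal of $c_i$; $\beta_i$ adjacent to $b$ and to each literal of $c_i$; each $y_i$ adjacent to $a$ and $b$. Then $G(\Phi,\varepsilon)$ is the complement of $H$, with $\delta=2t+k$ and $\Delta=n-m-3$. -}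

module Defs where

open import Data.Nat as ℕ using (ℕ; zero; suc; _+_; _*_; _∸_; _⊔_)
open import Data.Bool using (Bool; true; false; not; _∧_; if_then_else_)
open import Data.Fin using (Fin)
import Data.Fin as Fin
open import Data.Fin.Properties using () renaming (_≟_ to _≟F_)
import Data.Bool.Properties as BoolP
open import Data.Product using (_×_; _,_; ∃-syntax)
open import Data.Product.Properties using (≡-dec)
open import Data.Sum using (_⊎_)
open import Data.List using (List; []; _∷_; length; map; foldr; concatMap; allFin; _++_)
open import Data.Nat.ListAction using (sum)
open import Data.List.Relation.Unary.Unique.Propositional using (Unique)
open import Data.List.Membership.Propositional using (_∈_)
open import Data.Integer using (+_)
open import Data.Rational using (ℚ; _/_; 0ℚ; _<_; _≤_; _÷_; >-nonZero; NonZero)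
open import Relation.Nullary using (does)
open import Relation.Binary.Definitions using (DecidableEquality)
import Data.List.Membership.DecPropositional as DecMem

ℕtoℚ : ℕ → ℚ
ℕtoℚ n = + n / 1

-- A literal over atoms x_0..x_{t-1}: (x , true) is x, (x , false) is ¬x.
Lit : ℕ → Set
Lit t = Fin t × Bool

_≟L_ : ∀ {t} → DecidableEquality (Lit t)
_≟L_ = ≡-dec _≟F_ BoolP._≟_

neg : ∀ {t} → Lit t → Lit t
neg (x , s) = (x , not s)

allLits : (t : ℕ) → List (Lit t)
allLits t = concatMap (λ x → (x , true) ∷ (x , false) ∷ []) (allFin t)

record CNF : Set where
  field
    t : ℕ
    k : ℕ
    clause   : Fin k → List (Lit t)
    distinct : ∀ i → Unique (clause i)
    occurs   : ∀ (x : Fin t) → ∃[ i ] ((x , true) ∈ clause i ⊎ (x , false) ∈ clause i)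
open CNF public

NonTrivial : CNF → Set
NonTrivial Φ = (1 ℕ.≤ k Φ) × (∀ i → 1 ℕ.≤ length (clause Φ i))

module _ (Φ : CNF) where
  private module M = DecMem (_≟L_ {t Φ})

  inClause : Lit (t Φ) → Fin (k Φ) → Bool
  inClause ℓ i = does (ℓ M.∈? clause Φ i)

  width : Fin (k Φ) → ℕ
  width i = length (clause Φ i)

  occ : Lit (t Φ) → ℕ
  occ ℓ = sum (map (λ i → if inClause ℓ i then 1 else 0) (allFin (k Φ)))

  mΦ : ℕ
  mΦ = foldr _⊔_ 0 (map width (allFin (k Φ)) ++ map (λ ℓ → 2 * occ ℓ) (allLits (t Φ)))

  nV : ℕ → ℕ
  nV f = 2 + 2 * t Φ + 2 * k Φ + f

  δΦ : ℕ
  δΦ = 2 * t Φ + k Φ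

  ΔΦ : ℕ → ℕ
  ΔΦ f = nV f ∸ mΦ ∸ 3

  Admissible : (ε : ℚ) → 0ℚ < ε → ℕ → Set
  Admissible ε ε>0 f =
    (mΦ ℕ.≤ f) × (ℕtoℚ (2 * t Φ + k Φ) ÷ ε) ≤ ℕtoℚ (nV f) × (ℕtoℚ (mΦ + 3) ÷ ε) ≤ ℕtoℚ (nV f)
    where instance
            nz : NonZero ε
            nz = >-nonZero ε>0

  ChosenF : (ε : ℚ) → 0ℚ < ε → ℕ → Set
  ChosenF ε ε>0 f = Admissible ε ε>0 f × (∀ f′ → Admissible ε ε>0 f′ → f ℕ.≤ f′)

  data Vertex (f : ℕ) : Set where
    va vb : Vertex f
    lit   : Lit (t Φ) → Vertex f
    vα vβ : Fin (k Φ) → Vertex f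
    vy    : Fin f → Vertex f

  allVertices : (f : ℕ) → List (Vertex f)
  allVertices f = va ∷ vb ∷ map lit (allLits (t Φ)) ++ map vα (allFin (k Φ))
                  ++ map vβ (allFin (k Φ)) ++ map vy (allFin f)

  eqV : ∀ {f} → Vertex f → Vertex f → Bool
  eqV va va = true
  eqV vb vb = true
  eqV (lit ℓ) (lit ℓ′) = does (ℓ ≟L ℓ′)
  eqV (vα i) (vα j) = does (i ≟F j)
  eqV (vβ i) (vβ j) = does (i ≟F j)
  eqV (vy i) (vy j) = does (i ≟F j)
  eqV _ _ = false

  adjH : ∀ {f} → Vertex f → Vertex f → Bool
  adjH va vb = true
  adjH vb va = true
  adjH (lit ℓ) (lit ℓ′) = does (ℓ′ ≟L neg ℓ)
  adjH (vα i) va = true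
  adjH va (vα i) = true
  adjH (vα i) (lit ℓ) = inClause ℓ i
  adjH (lit ℓ) (vα i) = inClause ℓ i
  adjH (vβ i) vb = true
  adjH vb (vβ i) = true
  adjH (vβ i) (lit ℓ) = inClause ℓ i
  adjH (lit ℓ) (vβ i) = inClause ℓ i
  adjH (vy i) va = true
  adjH va (vy i) = true
  adjH (vy i) vb = true
  adjH vb (vy i) = true
  adjH _ _ = false

  adjG : ∀ {f} → Vertex f → Vertex f → Bool
  adjG u v = not (eqV u v) ∧ not (adjH u v)

  degG : ∀ {f} → Vertex f → ℕ
  degG {f} v = sum (map (λ w → if adjG v w then 1 else 0) (allVertices f))

{-# OPTIONS --safe #-}
module Submission where

-- H has few edges: apart from a and b, every vertex v has a closed H-neighbourhood of size at
-- most m + 2 (2 + 2p(ℓ) for a literal ℓ, 2 + w_i for α_i and β_i, 3 for a filler), so its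
-- degree n − |N_H[v]| in the complement G is at least n − m − 2 > Δ.  The vertices a and b
-- are adjacent in G to exactly the 2t literals and the k clause vertices of the other side,
-- so their degree is 2t + k = δ.  The bounds on δ and Δ are the admissibility conditions on
-- f read through n = Δ + (m + 3); for ε = 1/(F+1) they say that δ(F+1) and (m+3)(F+1) are at
-- most n, hence so is Fδ + (m + 3).

open import Defs
open import Data.Nat as ℕ using (ℕ; suc)

module Counting where
  open import Data.Nat using (ℕ; suc; _+_; _≤_; z≤n; s≤s)
  open import Data.Nat.Properties using (≤-reflexive; ≤-trans; +-mono-≤; +-monoʳ-≤; +-suc; n≤1+n)
  open import Data.Nat.ListAction using (sum)
  open import Data.Nat.ListAction.Properties using (sum-++)
  open import Data.Bool using (Bool; true; false; not; _∧_; _∨_; T; if_then_else_)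
  open import Data.List using (List; []; _∷_; length; map; _++_)
  open import Data.List.Properties using (map-++; map-∘)
  open import Data.List.Relation.Unary.All as All using (All; []; _∷_)
  open import Data.List.Relation.Unary.Unique.Propositional using (Unique)
  open import Data.List.Relation.Unary.AllPairs using ([]; _∷_)
  import Data.List.Membership.DecPropositional as DecMembership
  open import Function using (_∘_)
  open import Relation.Binary.Definitions using (DecidableEquality)
  open import Relation.Binary.PropositionalEquality using (_≡_; refl; sym; trans; cong)
  open import Relation.Nullary using (Dec; yes; does; ¬_)
  open import Data.Empty using (⊥-elim)

  does-sound : {P : Set} (P? : Dec P) → T (does P?) → P
  does-sound (yes p) _ = p

  count : {A : Set} → (A → Bool) → List A → ℕ
  count P xs = sum (map (λ x → if P x then 1 else 0) xs)

  count-map : {A B : Set} (P : A → Bool) (g : B → A) (xs : List B) → count P (map g xs) ≡ count (P ∘ g) xs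
  count-map P g xs = cong sum (sym (map-∘ xs))

  module _ {A : Set} where

    count-++ : (P : A → Bool) (xs ys : List A) → count P (xs ++ ys) ≡ count P xs + count P ys
    count-++ P xs ys = trans (cong sum (map-++ _ xs ys)) (sum-++ (map _ xs) _)

    count-++-≤ : (P : A → Bool) (xs ys : List A) {a b : ℕ} → count P xs ≤ a → count P ys ≤ b → count P (xs ++ ys) ≤ a + b
    count-++-≤ P xs ys ≤a ≤b = ≤-trans (≤-reflexive (count-++ P xs ys)) (+-mono-≤ ≤a ≤b)

    count-≤-length : (P : A → Bool) (xs : List A) → count P xs ≤ length xs
    count-≤-length P [] = z≤n
    count-≤-length P (x ∷ xs) with P x
    ... | true  = s≤s (count-≤-length P xs)
    ... | false = ≤-trans (count-≤-length P xs) (n≤1+n _)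

    count-false : (xs : List A) → count (λ _ → false) xs ≡ 0
    count-false []       = refl
    count-false (_ ∷ xs) = count-false xs

    count-∨ : (P Q : A → Bool) (xs : List A) → count (λ x → P x ∨ Q x) xs ≤ count P xs + count Q xs
    count-∨ P Q [] = z≤n
    count-∨ P Q (x ∷ xs) with P x | Q x
    ... | true  | true  = s≤s (≤-trans (count-∨ P Q xs) (+-monoʳ-≤ (count P xs) (n≤1+n _)))
    ... | true  | false = s≤s (count-∨ P Q xs)
    ... | false | true  = ≤-trans (s≤s (count-∨ P Q xs)) (≤-reflexive (sym (+-suc _ _)))
    ... | false | false = count-∨ P Q xs

    count-nor+count-∨ : (P Q : A → Bool) (xs : List A) →
      count (λ x → not (P x) ∧ not (Q x)) xs + count (λ x → P x ∨ Q x) xs ≡ length xs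
    count-nor+count-∨ P Q [] = refl
    count-nor+count-∨ P Q (x ∷ xs) with P x | Q x
    ... | true  | _     = trans (+-suc _ _) (cong suc (count-nor+count-∨ P Q xs))
    ... | false | true  = trans (+-suc _ _) (cong suc (count-nor+count-∨ P Q xs))
    ... | false | false = cong suc (count-nor+count-∨ P Q xs)

    count-none : ∀ {P : A → Bool} {xs} → All (λ x → ¬ T (P x)) xs → count P xs ≡ 0
    count-none [] = refl
    count-none {P} {x ∷ _} (¬Px ∷ ¬Pxs) with P x
    ... | true  = ⊥-elim (¬Px _)
    ... | false = count-none ¬Pxs

    count-unique-≤1 : ∀ {P : A → Bool} {x xs} → Unique xs → (∀ {y} → T (P y) → y ≡ x) → count P xs ≤ 1
    count-unique-≤1 [] _ = z≤n
    count-unique-≤1 {P} {x} {y ∷ ys} (y∉ys ∷ ys!) P⇒≡x with P y | P⇒≡x {y}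
    ... | true  | y≡x = s≤s (≤-reflexive (count-none (All.map (λ y≢z Pz → y≢z (trans (y≡x _) (sym (P⇒≡x Pz)))) y∉ys)))
    ... | false | _   = count-unique-≤1 ys! P⇒≡x

    module _ (_≟_ : DecidableEquality A) where
      open DecMembership _≟_ using (_∈?_)

      count-∈?-≤-length : ∀ {xs} → Unique xs → (c : List A) → count (λ y → does (y ∈? c)) xs ≤ length c
      count-∈?-≤-length {xs} xs! [] = ≤-reflexive (count-false xs)
      count-∈?-≤-length {xs} xs! (z ∷ c) =
        ≤-trans (count-∨ (λ y → does (y ≟ z)) (λ y → does (y ∈? c)) xs)
                (+-mono-≤ (count-unique-≤1 xs! (does-sound (_ ≟ z))) (count-∈?-≤-length xs! c))

open Counting

module Literals where
  open import Data.Nat using (_+_; _*_)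
  open import Data.Nat.Properties using (*-suc)
  open import Data.Bool using (true; false)
  open import Data.Fin using (Fin)
  open import Data.Product using (_,_)
  open import Data.List using (List; []; _∷_; length; concatMap; allFin)
  open import Data.List.Properties using (length-tabulate)
  open import Data.List.Relation.Unary.All using ([]; _∷_; universal)
  open import Data.List.Relation.Unary.AllPairs using ([]; _∷_)
  import Data.List.Relation.Unary.AllPairs.Properties as AllPairs
  import Data.List.Relation.Unary.AllPairs as AllPairs
  open import Data.List.Relation.Unary.Any using (here; there)
  open import Data.List.Relation.Unary.Unique.Propositional using (Unique)
  open import Data.List.Relation.Unary.Unique.Propositional.Properties using (allFin⁺; concat⁺)
  import Data.List.Relation.Unary.All.Properties as All
  open import Data.List.Relation.Binary.Disjoint.Propositional using (Disjoint)
  open import Data.List.Membership.Propositional using (_∈_)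
  open import Data.List.Membership.Propositional.Properties using (∈-concat⁺′; ∈-map⁺; ∈-allFin)
  open import Function using (id)
  open import Relation.Binary.PropositionalEquality using (_≡_; _≢_; refl; sym; trans; cong)

  length-allFin : ∀ n → length (allFin n) ≡ n
  length-allFin n = length-tabulate id

  literalsOf : ∀ {t} → Fin t → List (Lit t)
  literalsOf x = (x , true) ∷ (x , false) ∷ []

  length-concatMap-literalsOf : ∀ {t} (xs : List (Fin t)) → length (concatMap literalsOf xs) ≡ 2 * length xs
  length-concatMap-literalsOf []       = refl
  length-concatMap-literalsOf (x ∷ xs) = trans (cong (2 +_) (length-concatMap-literalsOf xs)) (sym (*-suc 2 (length xs)))

  length-allLits : ∀ t → length (allLits t) ≡ 2 * t
  length-allLits t = trans (length-concatMap-literalsOf (allFin t)) (cong (2 *_) (length-allFin t))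

  literalsOf-unique : ∀ {t} (x : Fin t) → Unique (literalsOf x)
  literalsOf-unique x = ((λ ()) ∷ []) ∷ [] ∷ []

  literalsOf-disjoint : ∀ {t} {x y : Fin t} → x ≢ y → Disjoint (literalsOf x) (literalsOf y)
  literalsOf-disjoint x≢y (here refl , here refl) = x≢y refl
  literalsOf-disjoint x≢y (there (here refl) , there (here refl)) = x≢y refl
  literalsOf-disjoint x≢y (here refl , there (here ()))
  literalsOf-disjoint x≢y (there (here refl) , here ())
  literalsOf-disjoint x≢y (there (there ()) , _)
  literalsOf-disjoint x≢y (_ , there (there ()))

  ∈-allLits : ∀ {t} (ℓ : Lit t) → ℓ ∈ allLits t
  ∈-allLits (x , true)  = ∈-concat⁺′ (here refl) (∈-map⁺ literalsOf (∈-allFin x))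
  ∈-allLits (x , false) = ∈-concat⁺′ (there (here refl)) (∈-map⁺ literalsOf (∈-allFin x))

  allLits-unique : ∀ t → Unique (allLits t)
  allLits-unique t = concat⁺ (All.map⁺ (universal literalsOf-unique (allFin t)))
                             (AllPairs.map⁺ (AllPairs.map literalsOf-disjoint (allFin⁺ t)))

module FormulaGraph (Φ : CNF) {f : ℕ} where
  open import Data.Nat.Tactic.RingSolver using (solve-∀)
  open Literals
  open import Data.Nat using (ℕ; _+_; _*_; _≤_; z≤n; s≤s)
  open import Data.Nat.Properties using (≤-refl; ≤-reflexive; ≤-trans; +-mono-≤; +-identityʳ; +-comm)
  open import Data.Bool using (Bool; false; _∨_)
  open import Data.Fin using (Fin)
  open import Data.Fin.Properties using () renaming (_≟_ to _≟F_)
  open import Data.List using (List; []; _∷_; length; map; _++_; allFin)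
  open import Data.List.Properties using (length-++; length-map)
  open import Data.List.Relation.Unary.Unique.Propositional.Properties using (allFin⁺)
  open import Function using (_∘_)
  open import Relation.Binary.PropositionalEquality using (_≡_; refl; sym; trans; cong)
  open import Relation.Nullary using (does)

  inClosedNbhH : Vertex Φ f → Vertex Φ f → Bool
  inClosedNbhH v w = eqV Φ v w ∨ adjH Φ v w

  closedDegH : Vertex Φ f → ℕ
  closedDegH v = count (inClosedNbhH v) (allVertices Φ f)

  length-allVertices : length (allVertices Φ f) ≡ nV Φ f
  length-allVertices = trans (cong (2 +_) blocks) (rearrange (t Φ) (k Φ) f)
    where
      length-map-++ : ∀ {B a b} (g : B → Vertex Φ f) xs {ys} →
        length xs ≡ a → length ys ≡ b → length (map g xs ++ ys) ≡ a + b
      length-map-++ g xs {ys} refl refl = trans (length-++ (map g xs)) (cong (_+ length ys) (length-map g xs))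
      blocks : length (map lit (allLits (t Φ)) ++ map vα (allFin (k Φ)) ++ map vβ (allFin (k Φ)) ++ map vy (allFin f))
               ≡ 2 * t Φ + (k Φ + (k Φ + f))
      blocks = length-map-++ lit (allLits (t Φ)) (length-allLits (t Φ))
        (length-map-++ vα (allFin (k Φ)) (length-allFin (k Φ))
          (length-map-++ vβ (allFin (k Φ)) (length-allFin (k Φ))
            (trans (length-map vy (allFin f)) (length-allFin f))))
      rearrange : ∀ t k f → 2 + (2 * t + (k + (k + f))) ≡ 2 + 2 * t + 2 * k + f
      rearrange = solve-∀

  degG+closedDegH≡n : ∀ v → degG Φ v + closedDegH v ≡ nV Φ f
  degG+closedDegH≡n v = trans (count-nor+count-∨ (eqV Φ v) (adjH Φ v) (allVertices Φ f)) length-allVertices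

  count-allVertices-≤ : ∀ (P : Vertex Φ f → Bool) {a l α β y} →
    count P (va ∷ vb ∷ []) ≤ a → count (P ∘ lit) (allLits (t Φ)) ≤ l →
    count (P ∘ vα) (allFin (k Φ)) ≤ α → count (P ∘ vβ) (allFin (k Φ)) ≤ β → count (P ∘ vy) (allFin f) ≤ y →
    count P (allVertices Φ f) ≤ a + (l + (α + (β + y)))
  count-allVertices-≤ P ≤a ≤l ≤α ≤β ≤y =
    count-++-≤ P (va ∷ vb ∷ []) (map lit Ls ++ map vα Ks ++ map vβ Ks ++ map vy Ys) ≤a
      (count-++-≤ P (map lit Ls) (map vα Ks ++ map vβ Ks ++ map vy Ys) (block lit Ls ≤l)
        (count-++-≤ P (map vα Ks) (map vβ Ks ++ map vy Ys) (block vα Ks ≤α)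
          (count-++-≤ P (map vβ Ks) (map vy Ys) (block vβ Ks ≤β) (block vy Ys ≤y))))
    where
      Ls : List (Lit (t Φ))
      Ls = allLits (t Φ)
      Ks : List (Fin (k Φ))
      Ks = allFin (k Φ)
      Ys : List (Fin f)
      Ys = allFin f
      block : ∀ {B b} (g : B → Vertex Φ f) xs → count (P ∘ g) xs ≤ b → count P (map g xs) ≤ b
      block g xs = ≤-trans (≤-reflexive (count-map P g xs))

  -- H has no edges inside the blocks α, β and y, so a vertex meets its own block only in itself.
  count-self-≤1 : ∀ {n} (i : Fin n) → count (λ j → does (i ≟F j) ∨ false) (allFin n) ≤ 1
  count-self-≤1 {n} i = ≤-trans (count-∨ (λ j → does (i ≟F j)) (λ _ → false) (allFin n))
    (+-mono-≤ (count-unique-≤1 (allFin⁺ n) (λ i≡j → sym (does-sound (i ≟F _) i≡j))) (≤-reflexive (count-false (allFin n))))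

  count-allLits-≤ : (P : Lit (t Φ) → Bool) → count P (allLits (t Φ)) ≤ 2 * t Φ
  count-allLits-≤ P = ≤-trans (count-≤-length P (allLits (t Φ))) (≤-reflexive (length-allLits (t Φ)))

  count-clauses-≤ : (P : Fin (k Φ) → Bool) → count P (allFin (k Φ)) ≤ k Φ
  count-clauses-≤ P = ≤-trans (count-≤-length P (allFin (k Φ))) (≤-reflexive (length-allFin (k Φ)))

  degG-va≤δ : degG Φ va ≤ δΦ Φ
  degG-va≤δ = ≤-trans
    (count-allVertices-≤ (adjG Φ va) {a = 0} z≤n (count-allLits-≤ _) (≤-reflexive (count-false (allFin (k Φ))))
                         (count-clauses-≤ _) (≤-reflexive (count-false (allFin f))))
    (≤-reflexive (cong (2 * t Φ +_) (+-identityʳ (k Φ))))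

  degG-vb≤δ : degG Φ vb ≤ δΦ Φ
  degG-vb≤δ = ≤-trans
    (count-allVertices-≤ (adjG Φ vb) {a = 0} z≤n (count-allLits-≤ _) (count-clauses-≤ _)
                         (≤-reflexive (count-false (allFin (k Φ)))) (≤-reflexive (count-false (allFin f))))
    (≤-reflexive (cong (2 * t Φ +_) (+-identityʳ (k Φ))))

  closedDegH-lit : ∀ ℓ → closedDegH (lit ℓ) ≤ 2 + 2 * occ Φ ℓ
  closedDegH-lit ℓ = count-allVertices-≤ (inClosedNbhH (lit ℓ)) {a = 0} z≤n literals-≤2 ≤-refl ≤-refl
                                          (≤-reflexive (count-false (allFin f)))
    where
      literals-≤2 : count (λ ℓ′ → does (ℓ ≟L ℓ′) ∨ does (ℓ′ ≟L neg ℓ)) (allLits (t Φ)) ≤ 2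
      literals-≤2 = ≤-trans (count-∨ (λ ℓ′ → does (ℓ ≟L ℓ′)) (λ ℓ′ → does (ℓ′ ≟L neg ℓ)) (allLits (t Φ)))
        (+-mono-≤ (count-unique-≤1 (allLits-unique (t Φ)) (λ ℓ≡ℓ′ → sym (does-sound (ℓ ≟L _) ℓ≡ℓ′)))
                  (count-unique-≤1 (allLits-unique (t Φ)) (does-sound (_ ≟L neg ℓ))))

  count-inClause-≤-width : ∀ i → count (λ ℓ → inClause Φ ℓ i) (allLits (t Φ)) ≤ width Φ i
  count-inClause-≤-width i = count-∈?-≤-length _≟L_ (allLits-unique (t Φ)) (clause Φ i)

  closedDegH-vα : ∀ i → closedDegH (vα i) ≤ 2 + width Φ i
  closedDegH-vα i = ≤-trans
    (count-allVertices-≤ (inClosedNbhH (vα i)) {a = 1} ≤-refl (count-inClause-≤-width i) (count-self-≤1 i)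
                         (≤-reflexive (count-false (allFin (k Φ)))) (≤-reflexive (count-false (allFin f))))
    (s≤s (≤-reflexive (+-comm (width Φ i) 1)))

  closedDegH-vβ : ∀ i → closedDegH (vβ i) ≤ 2 + width Φ i
  closedDegH-vβ i = ≤-trans
    (count-allVertices-≤ (inClosedNbhH (vβ i)) {a = 1} ≤-refl (count-inClause-≤-width i)
                         (≤-reflexive (count-false (allFin (k Φ)))) (count-self-≤1 i) (≤-reflexive (count-false (allFin f))))
    (s≤s (≤-reflexive (+-comm (width Φ i) 1)))

  closedDegH-vy : ∀ i → closedDegH (vy i) ≤ 3
  closedDegH-vy i = count-allVertices-≤ (inClosedNbhH (vy i)) {a = 2} ≤-refl (≤-reflexive (count-false (allLits (t Φ))))
    (≤-reflexive (count-false (allFin (k Φ)))) (≤-reflexive (count-false (allFin (k Φ)))) (count-self-≤1 i)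

module Arithmetic where
  open import Data.Nat using (ℕ; suc; _+_; _*_; _≤_; _⊔_)
  open import Data.Nat.Properties
  open import Data.List using (List; _∷_; foldr)
  open import Data.List.Membership.Propositional using (_∈_)
  open import Data.List.Relation.Unary.Any using (here; there)
  open import Relation.Binary.PropositionalEquality using (refl; sym; trans; cong)

  ∈⇒≤-foldr-⊔ : ∀ {x} (xs : List ℕ) → x ∈ xs → x ≤ foldr _⊔_ 0 xs
  ∈⇒≤-foldr-⊔ (y ∷ xs) (here refl) = m≤m⊔n y _
  ∈⇒≤-foldr-⊔ (y ∷ xs) (there x∈xs) = ≤-trans (∈⇒≤-foldr-⊔ xs x∈xs) (m≤n⊔m y _)

  F*d+M≤n : ∀ F d M {n} → d * suc F ≤ n → M * suc F ≤ n → F * d + M ≤ n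
  F*d+M≤n F d M {n} d[F+1]≤n M[F+1]≤n = begin
      F * d + M              ≤⟨ +-mono-≤ (*-monoʳ-≤ F (m≤m⊔n d M)) (m≤n⊔m d M) ⟩
      F * x + x              ≡⟨ trans (+-comm (F * x) x) (trans (cong (x +_) (*-comm F x)) (sym (*-suc x F))) ⟩
      x * suc F              ≡⟨ *-distribʳ-⊔ (suc F) d M ⟩
      d * suc F ⊔ M * suc F  ≤⟨ ⊔-lub d[F+1]≤n M[F+1]≤n ⟩
      n                      ∎
    where
      open ≤-Reasoning
      x : ℕ
      x = d ⊔ M

module RationalBounds where
  import Data.Nat.Coprimality as Coprime
  open import Data.Integer as ℤ using (+_)
  import Data.Integer.Properties as ℤ
  open import Data.Rational using (ℚ; mkℚ; 0ℚ; 1ℚ; _≤_; _<_; _+_; _*_; _-_; _/_; 1/_; _÷_; NonZero; >-nonZero; nonNegative)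
  open import Data.Rational.Properties
  open import Data.Rational.Solver using (module +-*-Solver)
  open import Relation.Binary.PropositionalEquality using (_≡_; refl; sym; trans; cong; cong₂; subst₂)
  open +-*-Solver

  -- + n / 1 only normalises through gcd n 1, whereas on the mkℚ form _+_ and _*_ compute.
  ℕtoℚ≡mkℚ : ∀ n → ℕtoℚ n ≡ mkℚ (+ n) 0 (Coprime.sym (Coprime.1-coprimeTo n))
  ℕtoℚ≡mkℚ n = normalize-coprime (Coprime.sym (Coprime.1-coprimeTo n))

  ℕtoℚ-homo-+ : ∀ a b → ℕtoℚ (a ℕ.+ b) ≡ ℕtoℚ a + ℕtoℚ b
  ℕtoℚ-homo-+ a b = trans (/-cong {+ (a ℕ.+ b)} {1} {+ a ℤ.* + 1 ℤ.+ + b ℤ.* + 1} {1} numerators refl)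
                          (sym (cong₂ _+_ (ℕtoℚ≡mkℚ a) (ℕtoℚ≡mkℚ b)))
    where
      numerators : + (a ℕ.+ b) ≡ + a ℤ.* + 1 ℤ.+ + b ℤ.* + 1
      numerators = trans (ℤ.pos-+ a b) (sym (cong₂ ℤ._+_ (ℤ.*-identityʳ (+ a)) (ℤ.*-identityʳ (+ b))))

  ℕtoℚ-homo-* : ∀ a b → ℕtoℚ (a ℕ.* b) ≡ ℕtoℚ a * ℕtoℚ b
  ℕtoℚ-homo-* a b = trans (/-cong {+ (a ℕ.* b)} {1} {+ a ℤ.* + b} {1} (ℤ.pos-* a b) refl)
                          (sym (cong₂ _*_ (ℕtoℚ≡mkℚ a) (ℕtoℚ≡mkℚ b)))

  ℕtoℚ-cancel-≤ : ∀ {a b} → ℕtoℚ a ≤ ℕtoℚ b → a ℕ.≤ b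
  ℕtoℚ-cancel-≤ {a} {b} a≤b = ℤ.drop‿+≤+
    (subst₂ ℤ._≤_ (ℤ.*-identityʳ (+ a)) (ℤ.*-identityʳ (+ b)) (drop-*≤* (subst₂ _≤_ (ℕtoℚ≡mkℚ a) (ℕtoℚ≡mkℚ b) a≤b)))

  ÷-≤⇒≤-* : ∀ {x y ε} (ε>0 : 0ℚ < ε) → (x ÷ ε) {{>-nonZero ε>0}} ≤ y → x ≤ ε * y
  ÷-≤⇒≤-* {x} {y} {ε} ε>0 x÷ε≤y = begin
      x                 ≡⟨ sym x÷ε*ε≡x ⟩
      x * 1/ ε * ε      ≤⟨ *-monoʳ-≤-nonNeg ε {{nonNegative (<⇒≤ ε>0)}} x÷ε≤y ⟩
      y * ε             ≡⟨ *-comm y ε ⟩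
      ε * y             ∎
    where
      open ≤-Reasoning
      instance
        ε≢0 : NonZero ε
        ε≢0 = >-nonZero ε>0
      x÷ε*ε≡x : x * 1/ ε * ε ≡ x
      x÷ε*ε≡x = trans (*-assoc x (1/ ε) ε) (trans (cong (x *_) (*-inverseˡ ε)) (*-identityʳ x))

  [1-ε]n≤r : ∀ ε r s {n} → r ℕ.+ s ≡ n → ℕtoℚ s ≤ ε * ℕtoℚ n → (1ℚ - ε) * ℕtoℚ n ≤ ℕtoℚ r
  [1-ε]n≤r ε r s refl s≤εn = begin
      (1ℚ - ε) * N           ≡⟨ expand ε N ⟩
      N - ε * N              ≤⟨ +-monoʳ-≤ N (neg-antimono-≤ s≤εn) ⟩
      N - ℕtoℚ s             ≡⟨ cong (_- ℕtoℚ s) (ℕtoℚ-homo-+ r s) ⟩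
      ℕtoℚ r + ℕtoℚ s - ℕtoℚ s ≡⟨ cancel (ℕtoℚ r) (ℕtoℚ s) ⟩
      ℕtoℚ r                 ∎
    where
      open ≤-Reasoning
      N : ℚ
      N = ℕtoℚ (r ℕ.+ s)
      expand : ∀ e N → (1ℚ - e) * N ≡ N - e * N
      expand = solve 2 (λ e N → (con 1ℚ :- e) :* N := N :- e :* N) refl
      cancel : ∀ p q → p + q - q ≡ p
      cancel = solve 2 (λ p q → p :+ q :- q := p) refl

  ÷-1/suc-≤⇒*-suc-≤ : ∀ x n F .{{_ : NonZero (+ 1 / suc F)}} →
                      ℕtoℚ x ÷ (+ 1 / suc F) ≤ ℕtoℚ n → x ℕ.* suc F ℕ.≤ n
  ÷-1/suc-≤⇒*-suc-≤ x n F x÷ε≤n =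
    ℕtoℚ-cancel-≤ (subst₂ _≤_ (trans (cong (ℕtoℚ x *_) 1/ε≡F+1) (sym (ℕtoℚ-homo-* x (suc F)))) refl x÷ε≤n)
    where
      1/-cong : ∀ {p q} → p ≡ q → .{{_ : NonZero p}} .{{_ : NonZero q}} → 1/ p ≡ 1/ q
      1/-cong refl = refl
      1/ε≡F+1 : 1/ (+ 1 / suc F) ≡ ℕtoℚ (suc F)
      1/ε≡F+1 = trans (1/-cong (normalize-coprime (Coprime.1-coprimeTo (suc F)))) (sym (ℕtoℚ≡mkℚ (suc F)))

module Thresholds (Φ : CNF) (f : ℕ) where
  open FormulaGraph Φ {f}
  open Arithmetic
  open RationalBounds using (÷-1/suc-≤⇒*-suc-≤)
  open import Data.Nat using (ℕ; suc; _+_; _*_; _≤_; _<_; s≤s)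
  open import Data.Nat.Properties
  open import Data.Fin using (fromℕ<)
  open import Data.Product using (_,_)
  open import Data.Sum using (_⊎_; inj₁; inj₂)
  open import Data.List using (map; allFin)
  open import Data.List.Membership.Propositional.Properties using (∈-map⁺; ∈-++⁺ˡ; ∈-++⁺ʳ; ∈-allFin)
  import Data.Integer as ℤ
  open import Data.Rational using (0ℚ; >-nonZero) renaming (_<_ to _<ℚ_; _/_ to _/ℚ_)
  open import Relation.Binary.PropositionalEquality using (_≡_; refl; sym; trans; cong; subst)

  width≤m : ∀ i → width Φ i ≤ mΦ Φ
  width≤m i = ∈⇒≤-foldr-⊔ _ (∈-++⁺ˡ (∈-map⁺ (width Φ) (∈-allFin i)))

  2*occ≤m : ∀ ℓ → 2 * occ Φ ℓ ≤ mΦ Φ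
  2*occ≤m ℓ = ∈⇒≤-foldr-⊔ _ (∈-++⁺ʳ (map (width Φ) (allFin (k Φ))) (∈-map⁺ (λ ℓ → 2 * occ Φ ℓ) (Literals.∈-allLits ℓ)))

  1≤m : NonTrivial Φ → 1 ≤ mΦ Φ
  1≤m (k≥1 , width≥1) = ≤-trans (width≥1 (fromℕ< k≥1)) (width≤m (fromℕ< k≥1))

  m+3≤n : NonTrivial Φ → mΦ Φ ≤ f → mΦ Φ + 3 ≤ nV Φ f
  m+3≤n (k≥1 , _) m≤f = ≤-trans (≤-reflexive (+-comm (mΦ Φ) 3)) (+-mono-≤ 3≤2+2t+2k m≤f)
    where
      3≤2+2t+2k : 3 ≤ 2 + 2 * t Φ + 2 * k Φ
      3≤2+2t+2k = s≤s (s≤s (≤-trans k≥1 (≤-trans (m≤m+n (k Φ) (k Φ + 0)) (m≤n+m (2 * k Φ) (2 * t Φ)))))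

  Δ+[m+3]≡n : NonTrivial Φ → mΦ Φ ≤ f → ΔΦ Φ f + (mΦ Φ + 3) ≡ nV Φ f
  Δ+[m+3]≡n nt m≤f = trans (cong (_+ (mΦ Φ + 3)) (∸-+-assoc (nV Φ f) (mΦ Φ) 3)) (m∸n+n≡m (m+3≤n nt m≤f))

  Δ<degG : NonTrivial Φ → mΦ Φ ≤ f → ∀ v → closedDegH v ≤ 2 + mΦ Φ → ΔΦ Φ f < degG Φ v
  Δ<degG nt m≤f v N[v]≤2+m = +-cancelʳ-≤ (2 + m) (suc Δ) (degG Φ v) (begin
      suc Δ + (2 + m)            ≡⟨ sym (trans (cong (Δ +_) (+-comm m 3)) (+-suc Δ (2 + m))) ⟩
      Δ + (m + 3)                ≡⟨ Δ+[m+3]≡n nt m≤f ⟩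
      nV Φ f                     ≡⟨ sym (degG+closedDegH≡n v) ⟩
      degG Φ v + closedDegH v    ≤⟨ +-monoʳ-≤ (degG Φ v) N[v]≤2+m ⟩
      degG Φ v + (2 + m)         ∎)
    where
      open ≤-Reasoning
      m Δ : ℕ
      m = mΦ Φ
      Δ = ΔΦ Φ f

  degG-dichotomy : NonTrivial Φ → mΦ Φ ≤ f → ∀ v → degG Φ v ≤ δΦ Φ ⊎ ΔΦ Φ f < degG Φ v
  degG-dichotomy nt m≤f va      = inj₁ degG-va≤δ
  degG-dichotomy nt m≤f vb      = inj₁ degG-vb≤δ
  degG-dichotomy nt m≤f (lit ℓ) = inj₂ (Δ<degG nt m≤f (lit ℓ) (≤-trans (closedDegH-lit ℓ) (+-monoʳ-≤ 2 (2*occ≤m ℓ))))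
  degG-dichotomy nt m≤f (vα i)  = inj₂ (Δ<degG nt m≤f (vα i) (≤-trans (closedDegH-vα i) (+-monoʳ-≤ 2 (width≤m i))))
  degG-dichotomy nt m≤f (vβ i)  = inj₂ (Δ<degG nt m≤f (vβ i) (≤-trans (closedDegH-vβ i) (+-monoʳ-≤ 2 (width≤m i))))
  degG-dichotomy nt m≤f (vy i)  = inj₂ (Δ<degG nt m≤f (vy i) (≤-trans (closedDegH-vy i) (+-monoʳ-≤ 2 (1≤m nt))))

  F*δ≤Δ : ∀ {ε} (ε>0 : 0ℚ <ℚ ε) F → Admissible Φ ε ε>0 f → ε ≡ ℤ.+ 1 /ℚ suc F → F * δΦ Φ ≤ ΔΦ Φ f
  F*δ≤Δ ε>0 F (_ , δ÷ε≤n , [m+3]÷ε≤n) refl =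
    subst (F * δΦ Φ ≤_) (sym (∸-+-assoc (nV Φ f) (mΦ Φ) 3))
      (m+n≤o⇒m≤o∸n (F * δΦ Φ) (F*d+M≤n F (δΦ Φ) (mΦ Φ + 3)
        (÷-1/suc-≤⇒*-suc-≤ (δΦ Φ) (nV Φ f) F {{>-nonZero ε>0}} δ÷ε≤n)
        (÷-1/suc-≤⇒*-suc-≤ (mΦ Φ + 3) (nV Φ f) F {{>-nonZero ε>0}} [m+3]÷ε≤n)))

open import Data.Product using (_×_; _,_)
open import Data.Sum using (_⊎_)
open import Data.Integer using (+_)
open import Data.Rational using (ℚ; 0ℚ; 1ℚ; ½; _<_; _≤_; _*_; _-_; _/_)
open import Relation.Binary.PropositionalEquality using (_≡_)
open RationalBounds using (÷-≤⇒≤-*; [1-ε]n≤r)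
open Thresholds using (Δ+[m+3]≡n; F*δ≤Δ; degG-dichotomy)

mainTheorem16 : (Φ : CNF) → NonTrivial Φ →
    (ε : ℚ) (ε>0 : 0ℚ < ε) → ε ≤ ½ →
    (f : ℕ) → ChosenF Φ ε ε>0 f →
    (ℕtoℚ (δΦ Φ) ≤ ε * ℕtoℚ (nV Φ f))
    × ((1ℚ - ε) * ℕtoℚ (nV Φ f) ≤ ℕtoℚ (ΔΦ Φ f))
    × (∀ (F : ℕ) → 1 ℕ.≤ F → ε ≡ + 1 / suc F → F ℕ.* δΦ Φ ℕ.≤ ΔΦ Φ f)
    × (∀ (v : Vertex Φ f) → degG Φ v ℕ.≤ δΦ Φ ⊎ ΔΦ Φ f ℕ.< degG Φ v)
mainTheorem16 Φ nt ε ε>0 _ f (admissible@(m≤f , δ÷ε≤n , [m+3]÷ε≤n) , _) =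
    ÷-≤⇒≤-* ε>0 δ÷ε≤n
  , [1-ε]n≤r ε (ΔΦ Φ f) (mΦ Φ ℕ.+ 3) (Δ+[m+3]≡n Φ f nt m≤f) (÷-≤⇒≤-* ε>0 [m+3]÷ε≤n)
  , (λ F _ → F*δ≤Δ Φ f ε>0 F admissible)
  , degG-dichotomy Φ f nt m≤f
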